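{- Let $q\ne\ell$ be distinct primes with $q$ odd, and let $u,v$ be integers such that $\Psi_q(u,v)\equiv0\pmod{\ell}$ and $(u,v)\not\equiv(0,0)\pmod{\ell}$. Then $$\frac{\partial\Psi_q}{\partial X}(u,v)\cdot\frac{\partial\Psi_q}{\partial Y}(u,v)\not\equiv 0\pmod{\ell}.$$
   Context: With $\zeta_q=e^{2\pi i/q}$, $\Psi_q(X,Y)=\prod_{j=1}^{(q-1)/2}\big(X-(\zeta_q^j+\zeta_q^{ -j}+2)Y\big)$, a polynomial in $\mathbb{Z}[X,Y]$; it satisfies $\Phi_q(X,Y)=\Psi_q((X+Y)^2,XY)$, where $\Phi_q(X,Y)=\prod_{j=1}^{q-1}(X-\zeta_q^jY)$ is the homogenized $q$-th cyclotomic polynomial. -}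

module Defs where

open import Data.Nat as ℕ using (ℕ; zero; suc; _∸_)
open import Data.Nat.DivMod using (_/_)
open import Data.Nat.Combinatorics using (_C_)
open import Data.Integer as ℤ using (ℤ; +_; -_)
open import Data.List using (List; []; _∷_; map; upTo)
open import Data.Product using (_×_; _,_)

-- Bivariate integer polynomials, as finite lists of monomials c · X^i · Y^j.
Poly2 : Set
Poly2 = List (ℤ × ℕ × ℕ)

eval : Poly2 → ℤ → ℤ → ℤ
eval [] x y = + 0
eval ((c , i , j) ∷ p) x y = c ℤ.* (x ℤ.^ i) ℤ.* (y ℤ.^ j) ℤ.+ eval p x y

∂X : Poly2 → Poly2
∂X [] = []
∂X ((c , zero , j) ∷ p) = ∂X p
∂X ((c , suc i , j) ∷ p) = (c ℤ.* + suc i , i , j) ∷ ∂X p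

∂Y : Poly2 → Poly2
∂Y [] = []
∂Y ((c , i , zero) ∷ p) = ∂Y p
∂Y ((c , i , suc j) ∷ p) = (c ℤ.* + suc j , i , j) ∷ ∂Y p

sign : ℕ → ℤ
sign zero = + 1
sign (suc k) = - sign k

-- Ψ_q(X,Y) = ∏_{j=1}^{(q-1)/2} (X - (ζ^j + ζ^{-j} + 2) Y)
--          = Σ_{k=0}^{m} (-1)^k C(2m-k, k) X^{m-k} Y^k,   m = (q-1)/2,
-- (the Chebyshev-U expansion of sin(qθ)/sin θ).
Ψ : ℕ → Poly2
Ψ q = map (λ k → (sign k ℤ.* + ((2 ℕ.* m ∸ k) C k) , m ∸ k , k)) (upTo (suc m))
  where m = q / 2

{-# OPTIONS --safe #-}
-- With P₀ = 1, P₁ = x and P_{n+2} = x P_{n+1} − y P_n one has Ψ_q(x², y) = P_{q−1}(x, y).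
-- For m = (q − 1)/2 write Ψ = P_{2m} and Θ = P_{2m−1}/x as polynomials in u = x², v = y.
-- They satisfy the Cassini identity Ψ² − u Θ_{m+1} Θ = v^{2m}, Euler's identity
-- u ∂_uΨ + v ∂_vΨ = m Ψ, and m Ψ = (u − 4v) ∂_uΨ + q v Θ.
-- Suppose ℓ ∣ Ψ(u, v). By Cassini ℓ ∤ u (else also ℓ ∣ v), and since Ψ ≡ u^m mod v, ℓ ∤ v.
-- If ℓ ∣ ∂_uΨ · ∂_vΨ, Euler gives ℓ ∣ ∂_uΨ, the third identity then gives ℓ ∣ Θ as ℓ ∤ q v,
-- and Cassini gives ℓ ∣ v, a contradiction.
module Submission where

open import Defs
open import Data.Nat using (ℕ; zero; suc; _∸_; _≤_; _<_; z<s; s<s; s≤s)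
import Data.Nat as ℕ
import Data.Nat.Properties as ℕₚ
import Data.Nat.Tactic.RingSolver as ℕ-Solver
open import Data.Nat.Combinatorics using (_C_; nCn≡1; nC1≡n; nCk+nC[k+1]≡[n+1]C[k+1])
open import Data.Nat.DivMod using (_/_; _%_; m≡m%n+[m/n]*n; m%n<n)
open import Data.Nat.Divisibility using (m%n≡0⇒n∣m; ∣1⇒≡1) renaming (_∣_ to _∣ℕ_)
open import Data.Nat.Primality using (Prime; euclidsLemma; prime⇒irreducible; prime⇒nonTrivial)
open import Data.List using ([]; _∷_; map; applyUpTo)
open import Data.List.Properties using (map-applyUpTo; map-upTo)
open import Data.List.Relation.Unary.All using (All; []; _∷_)
open import Data.List.Relation.Unary.All.Properties using (applyUpTo⁺₁)
open import Data.Product using (_×_; _,_; ∃-syntax)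
open import Data.Sum as Sum using (_⊎_; [_,_]; reduce)
open import Function using (_∘_; id)
open import Relation.Nullary using (¬_; contradiction)
open import Relation.Binary.PropositionalEquality
  using (_≡_; _≢_; refl; sym; trans; cong; cong₂; subst; module ≡-Reasoning)
open ≡-Reasoning

applyUpTo-cong : ∀ {A : Set} {f g : ℕ → A} n → (∀ {i} → i < n → f i ≡ g i) → applyUpTo f n ≡ applyUpTo g n
applyUpTo-cong zero    f≗g = refl
applyUpTo-cong (suc n) f≗g = cong₂ _∷_ (f≗g z<s) (applyUpTo-cong n (f≗g ∘ s<s))

module _ where
  open import Data.Nat using (_+_; _*_)
  open ℕ-Solver using (solve-∀)

  ¬2∣n⇒n≡1+2*[n/2] : ∀ n → ¬ 2 ∣ℕ n → n ≡ suc (2 * (n / 2))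
  ¬2∣n⇒n≡1+2*[n/2] n 2∤n = begin
    n                 ≡⟨ m≡m%n+[m/n]*n n 2 ⟩
    n % 2 + n / 2 * 2 ≡⟨ cong (_+ n / 2 * 2) n%2≡1 ⟩
    suc (n / 2 * 2)   ≡⟨ cong suc (ℕₚ.*-comm (n / 2) 2) ⟩
    suc (2 * (n / 2)) ∎
    where
    n%2≡1 : n % 2 ≡ 1
    n%2≡1 with n % 2 | m%n<n n 2 | m%n≡0⇒n∣m n 2
    ... | 0           | _            | 2∣n = contradiction (2∣n refl) 2∤n
    ... | 1           | _            | _   = refl
    ... | suc (suc _) | s≤s (s≤s ()) | _

  2m∸k≡2[m∸k]+k : ∀ {m k} → k ≤ m → 2 * m ∸ k ≡ 2 * (m ∸ k) + k
  2m∸k≡2[m∸k]+k {m} {k} k≤m = begin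
    2 * m ∸ k               ≡⟨ cong (λ x → 2 * x ∸ k) (ℕₚ.m∸n+n≡m k≤m) ⟨
    2 * (m ∸ k + k) ∸ k     ≡⟨ cong (_∸ k) (split (m ∸ k) k) ⟩
    2 * (m ∸ k) + k + k ∸ k ≡⟨ ℕₚ.m+n∸n≡m _ k ⟩
    2 * (m ∸ k) + k         ∎
    where
    split : ∀ r k → 2 * (r + k) ≡ 2 * r + k + k
    split = solve-∀

  pascal : ∀ n k → n C k + n C suc k ≡ suc n C suc k
  pascal = nCk+nC[k+1]≡[n+1]C[k+1]

  [1+k]*nC[1+k]+k*nCk≡n*nCk : ∀ n k → suc k * (n C suc k) + k * (n C k) ≡ n * (n C k)
  [1+k]*nC[1+k]+k*nCk≡n*nCk zero    zero    = refl
  [1+k]*nC[1+k]+k*nCk≡n*nCk zero    (suc k) =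
    cong₂ _+_ (ℕₚ.*-zeroʳ (suc (suc k))) (ℕₚ.*-zeroʳ (suc k))
  [1+k]*nC[1+k]+k*nCk≡n*nCk (suc n) zero    = begin
    1 * (suc n C 1) + 0 ≡⟨ ℕₚ.+-identityʳ _ ⟩
    1 * (suc n C 1)     ≡⟨ ℕₚ.*-identityˡ _ ⟩
    suc n C 1           ≡⟨ nC1≡n (suc n) ⟩
    suc n               ≡⟨ ℕₚ.*-identityʳ (suc n) ⟨
    suc n * 1           ∎
  [1+k]*nC[1+k]+k*nCk≡n*nCk (suc n) (suc k) = begin
    suc (suc k) * (suc n C suc (suc k)) + suc k * (suc n C suc k)
      ≡⟨ cong₂ (λ x y → suc (suc k) * x + suc k * y) (pascal n (suc k)) (pascal n k) ⟨
    suc (suc k) * (n C suc k + n C suc (suc k)) + suc k * (n C k + n C suc k)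
      ≡⟨ regroup k (n C k) (n C suc k) (n C suc (suc k)) ⟩
    (suc (suc k) * (n C suc (suc k)) + suc k * (n C suc k))
      + (suc k * (n C suc k) + k * (n C k)) + (n C k + n C suc k)
      ≡⟨ cong₂ (λ x y → x + y + (n C k + n C suc k))
           ([1+k]*nC[1+k]+k*nCk≡n*nCk n (suc k)) ([1+k]*nC[1+k]+k*nCk≡n*nCk n k) ⟩
    n * (n C suc k) + n * (n C k) + (n C k + n C suc k)
      ≡⟨ collect n (n C k) (n C suc k) ⟩
    suc n * (n C k + n C suc k)
      ≡⟨ cong (suc n *_) (pascal n k) ⟩
    suc n * (suc n C suc k) ∎
    where
    regroup : ∀ k a b c → suc (suc k) * (b + c) + suc k * (a + b)
              ≡ (suc (suc k) * c + suc k * b) + (suc k * b + k * a) + (a + b)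
    regroup = solve-∀
    collect : ∀ n a b → n * b + n * a + (a + b) ≡ suc n * (a + b)
    collect = solve-∀

  [1+k]*[r+k]C[1+k]≡r*[r+k]Ck : ∀ r k → suc k * ((r + k) C suc k) ≡ r * ((r + k) C k)
  [1+k]*[r+k]C[1+k]≡r*[r+k]Ck r k = ℕₚ.+-cancelʳ-≡ _ _ _ (begin
    suc k * ((r + k) C suc k) + k * ((r + k) C k) ≡⟨ [1+k]*nC[1+k]+k*nCk≡n*nCk (r + k) k ⟩
    (r + k) * ((r + k) C k)                      ≡⟨ ℕₚ.*-distribʳ-+ _ r k ⟩
    r * ((r + k) C k) + k * ((r + k) C k)         ∎)

  [1+r+k]*[r+k]Ck≡[1+r]*[1+r+k]Ck : ∀ r k → suc (r + k) * ((r + k) C k) ≡ suc r * (suc (r + k) C k)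
  [1+r+k]*[r+k]Ck≡[1+r]*[1+r+k]Ck r k = begin
    suc (r + k) * ((r + k) C k)                     ≡⟨ split r k ((r + k) C k) ⟩
    suc k * ((r + k) C k) + r * ((r + k) C k)        ≡⟨ cong (suc k * ((r + k) C k) +_) ([1+k]*[r+k]C[1+k]≡r*[r+k]Ck r k) ⟨
    suc k * ((r + k) C k) + suc k * ((r + k) C suc k) ≡⟨ ℕₚ.*-distribˡ-+ (suc k) ((r + k) C k) ((r + k) C suc k) ⟨
    suc k * ((r + k) C k + (r + k) C suc k)          ≡⟨ cong (suc k *_) (pascal (r + k) k) ⟩
    suc k * (suc (r + k) C suc k)                    ≡⟨ [1+k]*[r+k]C[1+k]≡r*[r+k]Ck (suc r) k ⟩
    suc r * (suc (r + k) C k)                        ∎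
    where
    split : ∀ r k c → suc (r + k) * c ≡ suc k * c + r * c
    split = solve-∀

  [1+b]*nC[1+b]+[3+2a+2b]*nCb≡4*[1+a]*[1+n]Cb : ∀ a b → let n = suc (2 * a + b) in
    suc b * (n C suc b) + suc (2 * (a + suc b)) * (n C b) ≡ 4 * (suc a * (suc n C b))
  [1+b]*nC[1+b]+[3+2a+2b]*nCb≡4*[1+a]*[1+n]Cb a b = begin
    suc b * (n C suc b) + suc (2 * (a + suc b)) * (n C b)
      ≡⟨ cong (_+ suc (2 * (a + suc b)) * (n C b)) ([1+k]*[r+k]C[1+k]≡r*[r+k]Ck (suc (2 * a)) b) ⟩
    suc (2 * a) * (n C b) + suc (2 * (a + suc b)) * (n C b)
      ≡⟨ collect a b (n C b) ⟩
    2 * (suc n * (n C b))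
      ≡⟨ cong (2 *_) ([1+r+k]*[r+k]Ck≡[1+r]*[1+r+k]Ck (suc (2 * a)) b) ⟩
    2 * (suc (suc (2 * a)) * (suc n C b))
      ≡⟨ double a (suc n C b) ⟩
    4 * (suc a * (suc n C b)) ∎
    where
    n = suc (2 * a + b)
    collect : ∀ a b c → suc (2 * a) * c + suc (2 * (a + suc b)) * c ≡ 2 * (suc (suc (2 * a + b)) * c)
    collect = solve-∀
    double : ∀ a c → 2 * (suc (suc (2 * a)) * c) ≡ 4 * (suc a * c)
    double = solve-∀

import Data.Integer as ℤ
open import Data.Integer using (ℤ; +_; _+_; _-_; -_; _*_; _^_; 0ℤ; 1ℤ; -1ℤ)
import Data.Integer.Properties as ℤₚ
open import Data.Integer.Divisibility using (_∣_)
open import Data.Integer.Divisibility.Signed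
  using (∣ᵤ⇒∣; ∣⇒∣ᵤ; ∣m⇒∣m*n; ∣n⇒∣m*n; ∣m∣n⇒∣m-n; ∣m+n∣m⇒∣n; ∣m+n∣n⇒∣m)
  renaming (_∣_ to _∣ₛ_)
open import Data.Integer.Tactic.RingSolver using (solve-∀)

module _ {ℓ} (ℓ-prime : Prime ℓ) where

  ∣m*n⇒∣m⊎∣n : ∀ x y → + ℓ ∣ₛ x * y → + ℓ ∣ₛ x ⊎ + ℓ ∣ₛ y
  ∣m*n⇒∣m⊎∣n x y ℓ∣xy = Sum.map ∣ᵤ⇒∣ ∣ᵤ⇒∣
    (euclidsLemma ℤ.∣ x ∣ ℤ.∣ y ∣ ℓ-prime (subst (ℓ ∣ℕ_) (ℤₚ.abs-* x y) (∣⇒∣ᵤ ℓ∣xy)))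

  ∣m*n∧∤m⇒∣n : ∀ x y → + ℓ ∣ₛ x * y → ¬ + ℓ ∣ₛ x → + ℓ ∣ₛ y
  ∣m*n∧∤m⇒∣n x y ℓ∣xy ℓ∤x = [ (λ ℓ∣x → contradiction ℓ∣x ℓ∤x) , id ] (∣m*n⇒∣m⊎∣n x y ℓ∣xy)

  ∣m^n⇒∣m : ∀ x n → + ℓ ∣ₛ x ^ n → + ℓ ∣ₛ x
  ∣m^n⇒∣m x zero    ℓ∣1 = contradiction (∣1⇒≡1 (∣⇒∣ᵤ ℓ∣1)) (ℕ.nonTrivial⇒≢1 {{prime⇒nonTrivial ℓ-prime}})
  ∣m^n⇒∣m x (suc n) ℓ∣xⁿ⁺¹ = [ id , ∣m^n⇒∣m x n ] (∣m*n⇒∣m⊎∣n x (x ^ n) ℓ∣xⁿ⁺¹)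

degree : ℤ × ℕ × ℕ → ℕ
degree (_ , i , j) = i ℕ.+ j

timesY : ℤ × ℕ × ℕ → ℤ × ℕ × ℕ
timesY (c , i , j) = (c , i , suc j)

∂X-map-timesY : ∀ p → ∂X (map timesY p) ≡ map timesY (∂X p)
∂X-map-timesY []                    = refl
∂X-map-timesY ((c , zero  , j) ∷ p) = ∂X-map-timesY p
∂X-map-timesY ((c , suc i , j) ∷ p) = cong (_ ∷_) (∂X-map-timesY p)

-- f : ℕ → ℕ → ℤ stands for the series Σ f a b Xᵃ Yᵇ, and form d f for its part of degree d.
mulX mulY divY ∂X-coeff : (ℕ → ℕ → ℤ) → ℕ → ℕ → ℤ
mulX f zero    b = 0ℤ
mulX f (suc a) b = f a b
mulY f a zero    = 0ℤ
mulY f a (suc b) = f a b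
divY f a b = f a (suc b)
∂X-coeff f a b = f (suc a) b * + suc a

form-term : ℕ → (ℕ → ℕ → ℤ) → ℕ → ℤ × ℕ × ℕ
form-term d f b = (f (d ∸ b) b , d ∸ b , b)

form : ℕ → (ℕ → ℕ → ℤ) → Poly2
form d f = applyUpTo (form-term d f) (suc d)

form-suc : ∀ d f → form (suc d) f ≡ (f (suc d) 0 , suc d , 0) ∷ map timesY (form d (divY f))
form-suc d f = cong (form-term (suc d) f 0 ∷_) (sym (map-applyUpTo (form-term d (divY f)) timesY (suc d)))

form-cong : ∀ d {f g} → (∀ {a b} → a ℕ.+ b ≡ d → f a b ≡ g a b) → form d f ≡ form d g
form-cong d {f} {g} f≗g = applyUpTo-cong {f = form-term d f} {g = form-term d g} (suc d) λ {b} b<1+d →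
  cong (λ c → (c , d ∸ b , b)) (f≗g {d ∸ b} {b} (ℕₚ.m∸n+n≡m (ℕₚ.≤-pred b<1+d)))

form-homogeneous : ∀ d f → All (λ t → degree t ≡ d) (form d f)
form-homogeneous d f = applyUpTo⁺₁ (form-term d f) (suc d) λ b<1+d → ℕₚ.m∸n+n≡m (ℕₚ.≤-pred b<1+d)

∂X-form-suc : ∀ d f → ∂X (form (suc d) f) ≡ form d (∂X-coeff f)
∂X-form-suc zero    f = refl
∂X-form-suc (suc d) f = begin
  ∂X (form (suc (suc d)) f)                    ≡⟨ cong ∂X (form-suc (suc d) f) ⟩
  t ∷ ∂X (map timesY (form (suc d) (divY f)))  ≡⟨ cong (t ∷_) (∂X-map-timesY (form (suc d) (divY f))) ⟩
  t ∷ map timesY (∂X (form (suc d) (divY f)))  ≡⟨ cong (λ p → t ∷ map timesY p) (∂X-form-suc d (divY f)) ⟩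
  t ∷ map timesY (form d (∂X-coeff (divY f)))  ≡⟨ form-suc d (∂X-coeff f) ⟨
  form (suc d) (∂X-coeff f)                    ∎
  where
  t = (∂X-coeff f (suc d) 0 , suc d , 0)

-- The coefficient of xⁱ yʲ in P_{i+2j}.
P-coeff : ℕ → ℕ → ℤ
P-coeff i j = sign j * + ((i ℕ.+ j) C j)

P-coeff-suc : ∀ i j → P-coeff (suc i) (suc j) ≡ P-coeff i (suc j) - P-coeff (suc i) j
P-coeff-suc i j = begin
  - s * + (suc n C suc j)              ≡⟨ cong (λ c → - s * + c) (pascal n j) ⟨
  - s * (+ (n C j) + + (n C suc j))    ≡⟨ distrib s (+ (n C j)) (+ (n C suc j)) ⟩
  - s * + (n C suc j) - s * + (n C j)  ≡⟨ cong (λ m → - s * + (n C suc j) - s * + (m C j)) (ℕₚ.+-suc i j) ⟩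
  P-coeff i (suc j) - P-coeff (suc i) j ∎
  where
  n = i ℕ.+ suc j
  s = sign j
  distrib : ∀ s a b → - s * (a + b) ≡ - s * b - s * a
  distrib = solve-∀

ψ θ : ℕ → ℕ → ℤ
ψ a b = P-coeff (2 ℕ.* a) b
θ a b = P-coeff (suc (2 ℕ.* a)) b

ψ-suc : ∀ a b → ψ (suc a) b ≡ P-coeff (suc (suc (2 ℕ.* a))) b
ψ-suc a b = cong (λ i → P-coeff i b) (ℕₚ.*-suc 2 a)

θ≡ψ-Yθ : ∀ a b → θ a b ≡ ψ a b - mulY θ a b
θ≡ψ-Yθ a zero    = refl
θ≡ψ-Yθ a (suc b) = P-coeff-suc (2 ℕ.* a) b

ψ≡Xθ-Yψ : ∀ {d} a b → a ℕ.+ b ≡ suc d → ψ a b ≡ mulX θ a b - mulY ψ a b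
ψ≡Xθ-Yψ (suc a) zero    _ = refl
ψ≡Xθ-Yψ zero    (suc b) _ = begin
  - sign b * + (suc b C suc b) ≡⟨ cong (λ x → - sign b * + x) (nCn≡1 (suc b)) ⟩
  - sign b * 1ℤ                ≡⟨ neg (sign b) ⟩
  0ℤ - sign b * 1ℤ             ≡⟨ cong (λ x → 0ℤ - sign b * + x) (nCn≡1 b) ⟨
  0ℤ - ψ 0 b                   ∎
  where
  neg : ∀ s → - s * 1ℤ ≡ 0ℤ - s * 1ℤ
  neg = solve-∀
ψ≡Xθ-Yψ (suc a) (suc b) _ = begin
  ψ (suc a) (suc b)                              ≡⟨ ψ-suc a (suc b) ⟩
  P-coeff (suc (suc (2 ℕ.* a))) (suc b)          ≡⟨ P-coeff-suc (suc (2 ℕ.* a)) b ⟩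
  θ a (suc b) - P-coeff (suc (suc (2 ℕ.* a))) b  ≡⟨ cong (λ x → θ a (suc b) - x) (ψ-suc a b) ⟨
  θ a (suc b) - ψ (suc a) b                      ∎

[a+b]ψ≡[X-4Y]∂Xψ+[2a+2b+1]Yθ : ∀ a b → + (a ℕ.+ b) * ψ a b
  ≡ (+ a * ψ a b - + 4 * mulY (∂X-coeff ψ) a b) + + suc (2 ℕ.* (a ℕ.+ b)) * mulY θ a b
[a+b]ψ≡[X-4Y]∂Xψ+[2a+2b+1]Yθ a zero rewrite ℕₚ.+-identityʳ a = drop-zeros (+ a) (ψ a 0) (+ suc (2 ℕ.* a))
  where
  drop-zeros : ∀ x y z → x * y ≡ (x * y - + 4 * 0ℤ) + z * 0ℤ
  drop-zeros = solve-∀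
[a+b]ψ≡[X-4Y]∂Xψ+[2a+2b+1]Yθ a (suc b) = begin
  + (a ℕ.+ suc b) * ψ a (suc b)
    ≡⟨ cong (+ (a ℕ.+ suc b) *_) ψ-a-[1+b] ⟩
  (+ a + + suc b) * (- s * nC[1+b])
    ≡⟨ expand (+ a) (+ suc b) s nC[1+b] Q nCb ⟩
  (+ a * (- s * nC[1+b]) + s * (Q * nCb)) - s * (+ suc b * nC[1+b] + Q * nCb)
    ≡⟨ cong (λ x → (+ a * (- s * nC[1+b]) + s * (Q * nCb)) - s * x) binomial ⟩
  (+ a * (- s * nC[1+b]) + s * (Q * nCb)) - s * (+ 4 * (+ suc a * [1+n]Cb))
    ≡⟨ collect (+ a) s nC[1+b] [1+n]Cb nCb Q (+ suc a) ⟩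
  (+ a * (- s * nC[1+b]) - + 4 * (s * [1+n]Cb * + suc a)) + Q * (s * nCb)
    ≡⟨ cong₂ (λ x y → (+ a * x - + 4 * (y * + suc a)) + Q * (s * nCb)) ψ-a-[1+b] (ψ-suc a b) ⟨
  (+ a * ψ a (suc b) - + 4 * (ψ (suc a) b * + suc a)) + Q * θ a b ∎
  where
  n = suc (2 ℕ.* a ℕ.+ b)
  s = sign b
  nC[1+b] = + (n C suc b)
  [1+n]Cb = + (suc n C b)
  nCb = + (n C b)
  Q = + suc (2 ℕ.* (a ℕ.+ suc b))
  ψ-a-[1+b] : ψ a (suc b) ≡ - s * nC[1+b]
  ψ-a-[1+b] = cong (λ m → - s * + (m C suc b)) (ℕₚ.+-suc (2 ℕ.* a) b)
  binomial : + suc b * nC[1+b] + Q * nCb ≡ + 4 * (+ suc a * [1+n]Cb)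
  binomial = begin
    + suc b * nC[1+b] + Q * nCb
      ≡⟨ cong₂ _+_ (ℤₚ.pos-* (suc b) (n C suc b)) (ℤₚ.pos-* (suc (2 ℕ.* (a ℕ.+ suc b))) (n C b)) ⟨
    + (suc b ℕ.* (n C suc b) ℕ.+ suc (2 ℕ.* (a ℕ.+ suc b)) ℕ.* (n C b))
      ≡⟨ cong +_ ([1+b]*nC[1+b]+[3+2a+2b]*nCb≡4*[1+a]*[1+n]Cb a b) ⟩
    + (4 ℕ.* (suc a ℕ.* (suc n C b)))
      ≡⟨ ℤₚ.pos-* 4 (suc a ℕ.* (suc n C b)) ⟩
    + 4 * + (suc a ℕ.* (suc n C b))
      ≡⟨ cong (+ 4 *_) (ℤₚ.pos-* (suc a) (suc n C b)) ⟩
    + 4 * (+ suc a * [1+n]Cb) ∎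
  expand : ∀ x y s c₁ q c₀ → (x + y) * (- s * c₁) ≡ (x * (- s * c₁) + s * (q * c₀)) - s * (y * c₁ + q * c₀)
  expand = solve-∀
  collect : ∀ x s c₁ c₂ c₀ q p → (x * (- s * c₁) + s * (q * c₀)) - s * (+ 4 * (p * c₂))
                              ≡ (x * (- s * c₁) - + 4 * (s * c₂ * p)) + q * (s * c₀)
  collect = solve-∀

Ψ≡form : ∀ q → Ψ q ≡ form (q / 2) ψ
Ψ≡form q = trans (map-upTo _ (suc m)) (applyUpTo-cong (suc m) λ {k} k<1+m →
  cong (λ n → (sign k * + (n C k) , m ∸ k , k)) (2m∸k≡2[m∸k]+k (ℕₚ.≤-pred k<1+m)))
  where
  m = q / 2

module _ (u v : ℤ) where

  ⟦_⟧ : Poly2 → ℤ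
  ⟦ p ⟧ = eval p u v

  X∂X-∷ : ∀ c i j p → u * ⟦ ∂X ((c , i , j) ∷ p) ⟧ ≡ + i * (c * u ^ i * v ^ j) + u * ⟦ ∂X p ⟧
  X∂X-∷ c zero    j p = alg u (c * 1ℤ * v ^ j) ⟦ ∂X p ⟧
    where
    alg : ∀ u t e → u * e ≡ 0ℤ * t + u * e
    alg = solve-∀
  X∂X-∷ c (suc i) j p = alg u c (+ suc i) (u ^ i) (v ^ j) ⟦ ∂X p ⟧
    where
    alg : ∀ u c n U V e → u * (c * n * U * V + e) ≡ n * (c * (u * U) * V) + u * e
    alg = solve-∀

  Y∂Y-∷ : ∀ c i j p → v * ⟦ ∂Y ((c , i , j) ∷ p) ⟧ ≡ + j * (c * u ^ i * v ^ j) + v * ⟦ ∂Y p ⟧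
  Y∂Y-∷ c i zero    p = alg v (c * u ^ i * 1ℤ) ⟦ ∂Y p ⟧
    where
    alg : ∀ v t e → v * e ≡ 0ℤ * t + v * e
    alg = solve-∀
  Y∂Y-∷ c i (suc j) p = alg v c (+ suc j) (u ^ i) (v ^ j) ⟦ ∂Y p ⟧
    where
    alg : ∀ v c n U V e → v * (c * n * U * V + e) ≡ n * (c * U * (v * V)) + v * e
    alg = solve-∀

  euler : ∀ {m} p → All (λ t → degree t ≡ m) p → u * ⟦ ∂X p ⟧ + v * ⟦ ∂Y p ⟧ ≡ + m * ⟦ p ⟧
  euler {m} [] [] = alg u v (+ m)
    where
    alg : ∀ u v m → u * 0ℤ + v * 0ℤ ≡ m * 0ℤ
    alg = solve-∀
  euler {m} ((c , i , j) ∷ p) (i+j≡m ∷ homogeneous) = begin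
    u * ⟦ ∂X ((c , i , j) ∷ p) ⟧ + v * ⟦ ∂Y ((c , i , j) ∷ p) ⟧
      ≡⟨ cong₂ _+_ (X∂X-∷ c i j p) (Y∂Y-∷ c i j p) ⟩
    (+ i * t + u * ⟦ ∂X p ⟧) + (+ j * t + v * ⟦ ∂Y p ⟧)
      ≡⟨ regroup (+ i) (+ j) t (u * ⟦ ∂X p ⟧) (v * ⟦ ∂Y p ⟧) ⟩
    (+ i + + j) * t + (u * ⟦ ∂X p ⟧ + v * ⟦ ∂Y p ⟧)
      ≡⟨ cong₂ (λ n e → + n * t + e) i+j≡m (euler p homogeneous) ⟩
    + m * t + + m * ⟦ p ⟧
      ≡⟨ ℤₚ.*-distribˡ-+ (+ m) t ⟦ p ⟧ ⟨
    + m * ⟦ (c , i , j) ∷ p ⟧ ∎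
    where
    t = c * u ^ i * v ^ j
    regroup : ∀ i j t x y → (i * t + x) + (j * t + y) ≡ (i + j) * t + (x + y)
    regroup = solve-∀

  eval-map-timesY : ∀ p → ⟦ map timesY p ⟧ ≡ v * ⟦ p ⟧
  eval-map-timesY [] = sym (ℤₚ.*-zeroʳ v)
  eval-map-timesY ((c , i , j) ∷ p) =
    trans (cong (_+_ (c * u ^ i * (v * v ^ j))) (eval-map-timesY p)) (alg c (u ^ i) v (v ^ j) ⟦ p ⟧)
    where
    alg : ∀ c U v V e → c * U * (v * V) + v * e ≡ v * (c * U * V + e)
    alg = solve-∀

  eval-form-suc : ∀ d f → ⟦ form (suc d) f ⟧ ≡ f (suc d) 0 * u ^ suc d + v * ⟦ form d (divY f) ⟧
  eval-form-suc d f = trans (cong ⟦_⟧ (form-suc d f))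
    (cong₂ _+_ (ℤₚ.*-identityʳ (f (suc d) 0 * u ^ suc d)) (eval-map-timesY (form d (divY f))))

  eval-form-+ : ∀ d f g → ⟦ form d (λ a b → f a b + g a b) ⟧ ≡ ⟦ form d f ⟧ + ⟦ form d g ⟧
  eval-form-+ zero    f g = alg (f 0 0) (g 0 0)
    where
    alg : ∀ x y → (x + y) * 1ℤ * 1ℤ + 0ℤ ≡ (x * 1ℤ * 1ℤ + 0ℤ) + (y * 1ℤ * 1ℤ + 0ℤ)
    alg = solve-∀
  eval-form-+ (suc d) f g = begin
    ⟦ form (suc d) (λ a b → f a b + g a b) ⟧
      ≡⟨ eval-form-suc d (λ a b → f a b + g a b) ⟩
    (f (suc d) 0 + g (suc d) 0) * u ^ suc d + v * ⟦ form d (λ a b → divY f a b + divY g a b) ⟧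
      ≡⟨ cong (λ e → (f (suc d) 0 + g (suc d) 0) * u ^ suc d + v * e) (eval-form-+ d (divY f) (divY g)) ⟩
    (f (suc d) 0 + g (suc d) 0) * u ^ suc d + v * (⟦ form d (divY f) ⟧ + ⟦ form d (divY g) ⟧)
      ≡⟨ alg (f (suc d) 0) (g (suc d) 0) (u ^ suc d) v ⟦ form d (divY f) ⟧ ⟦ form d (divY g) ⟧ ⟩
    (f (suc d) 0 * u ^ suc d + v * ⟦ form d (divY f) ⟧) + (g (suc d) 0 * u ^ suc d + v * ⟦ form d (divY g) ⟧)
      ≡⟨ cong₂ _+_ (eval-form-suc d f) (eval-form-suc d g) ⟨
    ⟦ form (suc d) f ⟧ + ⟦ form (suc d) g ⟧ ∎
    where
    alg : ∀ x y U v s t → (x + y) * U + v * (s + t) ≡ (x * U + v * s) + (y * U + v * t)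
    alg = solve-∀

  eval-form-* : ∀ d k f → ⟦ form d (λ a b → k * f a b) ⟧ ≡ k * ⟦ form d f ⟧
  eval-form-* zero    k f = alg k (f 0 0)
    where
    alg : ∀ k x → k * x * 1ℤ * 1ℤ + 0ℤ ≡ k * (x * 1ℤ * 1ℤ + 0ℤ)
    alg = solve-∀
  eval-form-* (suc d) k f = begin
    ⟦ form (suc d) (λ a b → k * f a b) ⟧
      ≡⟨ eval-form-suc d (λ a b → k * f a b) ⟩
    k * f (suc d) 0 * u ^ suc d + v * ⟦ form d (λ a b → k * divY f a b) ⟧
      ≡⟨ cong (λ e → k * f (suc d) 0 * u ^ suc d + v * e) (eval-form-* d k (divY f)) ⟩
    k * f (suc d) 0 * u ^ suc d + v * (k * ⟦ form d (divY f) ⟧)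
      ≡⟨ alg k (f (suc d) 0) (u ^ suc d) v ⟦ form d (divY f) ⟧ ⟩
    k * (f (suc d) 0 * u ^ suc d + v * ⟦ form d (divY f) ⟧)
      ≡⟨ cong (k *_) (eval-form-suc d f) ⟨
    k * ⟦ form (suc d) f ⟧ ∎
    where
    alg : ∀ k x U v s → k * x * U + v * (k * s) ≡ k * (x * U + v * s)
    alg = solve-∀

  eval-form-- : ∀ d f g → ⟦ form d (λ a b → f a b - g a b) ⟧ ≡ ⟦ form d f ⟧ - ⟦ form d g ⟧
  eval-form-- d f g = begin
    ⟦ form d (λ a b → f a b - g a b) ⟧
      ≡⟨ cong ⟦_⟧ (form-cong d λ {a} {b} _ → cong (_+_ (f a b)) (ℤₚ.-1*i≡-i (g a b))) ⟨
    ⟦ form d (λ a b → f a b + -1ℤ * g a b) ⟧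
      ≡⟨ eval-form-+ d f (λ a b → -1ℤ * g a b) ⟩
    ⟦ form d f ⟧ + ⟦ form d (λ a b → -1ℤ * g a b) ⟧
      ≡⟨ cong (_+_ ⟦ form d f ⟧) (trans (eval-form-* d -1ℤ g) (ℤₚ.-1*i≡-i ⟦ form d g ⟧)) ⟩
    ⟦ form d f ⟧ - ⟦ form d g ⟧ ∎

  eval-form-mulY : ∀ d f → ⟦ form (suc d) (mulY f) ⟧ ≡ v * ⟦ form d f ⟧
  eval-form-mulY d f = trans (eval-form-suc d (mulY f)) (ℤₚ.+-identityˡ (v * ⟦ form d f ⟧))

  eval-form-mulX : ∀ d f → ⟦ form (suc d) (mulX f) ⟧ ≡ u * ⟦ form d f ⟧
  eval-form-mulX zero    f = alg u v (f 0 0)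
    where
    alg : ∀ u v x → x * (u * 1ℤ) * 1ℤ + (0ℤ * 1ℤ * (v * 1ℤ) + 0ℤ) ≡ u * (x * 1ℤ * 1ℤ + 0ℤ)
    alg = solve-∀
  eval-form-mulX (suc d) f = begin
    ⟦ form (suc (suc d)) (mulX f) ⟧
      ≡⟨ eval-form-suc (suc d) (mulX f) ⟩
    f (suc d) 0 * u ^ suc (suc d) + v * ⟦ form (suc d) (divY (mulX f)) ⟧
      ≡⟨ cong (λ p → f (suc d) 0 * u ^ suc (suc d) + v * ⟦ p ⟧) (form-cong (suc d) λ {a} {b} _ → divY-mulX a {b}) ⟩
    f (suc d) 0 * u ^ suc (suc d) + v * ⟦ form (suc d) (mulX (divY f)) ⟧
      ≡⟨ cong (λ e → f (suc d) 0 * u ^ suc (suc d) + v * e) (eval-form-mulX d (divY f)) ⟩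
    f (suc d) 0 * u ^ suc (suc d) + v * (u * ⟦ form d (divY f) ⟧)
      ≡⟨ alg u v (f (suc d) 0) (u ^ suc d) ⟦ form d (divY f) ⟧ ⟩
    u * (f (suc d) 0 * u ^ suc d + v * ⟦ form d (divY f) ⟧)
      ≡⟨ cong (u *_) (eval-form-suc d f) ⟨
    u * ⟦ form (suc d) f ⟧ ∎
    where
    divY-mulX : ∀ a {b} → divY (mulX f) a b ≡ mulX (divY f) a b
    divY-mulX zero    = refl
    divY-mulX (suc a) = refl
    alg : ∀ u v x U s → x * (u * U) + v * (u * s) ≡ u * (x * U + v * s)
    alg = solve-∀

  eval-X∂X-form : ∀ d f → u * ⟦ ∂X (form (suc d) f) ⟧ ≡ ⟦ form (suc d) (λ a b → + a * f a b) ⟧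
  eval-X∂X-form d f = begin
    u * ⟦ ∂X (form (suc d) f) ⟧               ≡⟨ cong (λ p → u * ⟦ p ⟧) (∂X-form-suc d f) ⟩
    u * ⟦ form d (∂X-coeff f) ⟧               ≡⟨ eval-form-mulX d (∂X-coeff f) ⟨
    ⟦ form (suc d) (mulX (∂X-coeff f)) ⟧      ≡⟨ cong ⟦_⟧ (form-cong (suc d) λ {a} {b} _ → mulX-∂X-coeff a {b}) ⟩
    ⟦ form (suc d) (λ a b → + a * f a b) ⟧    ∎
    where
    mulX-∂X-coeff : ∀ a {b} → mulX (∂X-coeff f) a b ≡ + a * f a b
    mulX-∂X-coeff zero    = refl
    mulX-∂X-coeff (suc a) = ℤₚ.*-comm (f (suc a) _) (+ suc a)

  eval-[X-4Y]∂X-form : ∀ d f → (u - + 4 * v) * ⟦ ∂X (form (suc d) f) ⟧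
                       ≡ ⟦ form (suc d) (λ a b → + a * f a b - + 4 * mulY (∂X-coeff f) a b) ⟧
  eval-[X-4Y]∂X-form d f = begin
    (u - + 4 * v) * D
      ≡⟨ distrib u v D ⟩
    u * D - + 4 * (v * D)
      ≡⟨ cong₂ (λ x y → x - + 4 * y) (eval-X∂X-form d f) Y∂X ⟩
    ⟦ form (suc d) (λ a b → + a * f a b) ⟧ - + 4 * ⟦ form (suc d) (mulY (∂X-coeff f)) ⟧
      ≡⟨ cong (λ x → ⟦ form (suc d) (λ a b → + a * f a b) ⟧ - x) (eval-form-* (suc d) (+ 4) (mulY (∂X-coeff f))) ⟨
    ⟦ form (suc d) (λ a b → + a * f a b) ⟧ - ⟦ form (suc d) (λ a b → + 4 * mulY (∂X-coeff f) a b) ⟧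
      ≡⟨ eval-form-- (suc d) (λ a b → + a * f a b) (λ a b → + 4 * mulY (∂X-coeff f) a b) ⟨
    ⟦ form (suc d) (λ a b → + a * f a b - + 4 * mulY (∂X-coeff f) a b) ⟧ ∎
    where
    D = ⟦ ∂X (form (suc d) f) ⟧
    Y∂X : v * D ≡ ⟦ form (suc d) (mulY (∂X-coeff f)) ⟧
    Y∂X = trans (cong (λ p → v * ⟦ p ⟧) (∂X-form-suc d f)) (sym (eval-form-mulY d (∂X-coeff f)))
    distrib : ∀ u v D → (u - + 4 * v) * D ≡ u * D - + 4 * (v * D)
    distrib = solve-∀

  -- Ψ[ n ] = P_{2n} and Θ[ n ] = P_{2n−1}/x (with P_{−1} = 0), evaluated at x² = u, y = v.
  Ψ[_] Θ[_] : ℕ → ℤ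
  Ψ[ n ] = ⟦ form n ψ ⟧
  Θ[ zero ]  = 0ℤ
  Θ[ suc n ] = ⟦ form n θ ⟧

  Θ-suc : ∀ n → Θ[ suc n ] ≡ Ψ[ n ] - v * Θ[ n ]
  Θ-suc n = begin
    ⟦ form n θ ⟧                             ≡⟨ cong ⟦_⟧ (form-cong n λ {a} {b} _ → θ≡ψ-Yθ a b) ⟩
    ⟦ form n (λ a b → ψ a b - mulY θ a b) ⟧  ≡⟨ eval-form-- n ψ (mulY θ) ⟩
    Ψ[ n ] - ⟦ form n (mulY θ) ⟧             ≡⟨ cong (λ x → Ψ[ n ] - x) (Yθ n) ⟩
    Ψ[ n ] - v * Θ[ n ]                      ∎
    where
    Yθ : ∀ n → ⟦ form n (mulY θ) ⟧ ≡ v * Θ[ n ]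
    Yθ zero    = sym (ℤₚ.*-zeroʳ v)
    Yθ (suc n) = eval-form-mulY n θ

  Ψ-suc : ∀ n → Ψ[ suc n ] ≡ u * Θ[ suc n ] - v * Ψ[ n ]
  Ψ-suc n = begin
    ⟦ form (suc n) ψ ⟧                               ≡⟨ cong ⟦_⟧ (form-cong (suc n) λ {a} {b} → ψ≡Xθ-Yψ a b) ⟩
    ⟦ form (suc n) (λ a b → mulX θ a b - mulY ψ a b) ⟧ ≡⟨ eval-form-- (suc n) (mulX θ) (mulY ψ) ⟩
    ⟦ form (suc n) (mulX θ) ⟧ - ⟦ form (suc n) (mulY ψ) ⟧ ≡⟨ cong₂ _-_ (eval-form-mulX n θ) (eval-form-mulY n ψ) ⟩
    u * Θ[ suc n ] - v * Ψ[ n ]                      ∎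

  cassini : ∀ n → Ψ[ n ] * Ψ[ n ] - u * (Θ[ suc n ] * Θ[ n ]) ≡ (v * v) ^ n
  cassini zero    = alg u Θ[ 1 ]
    where
    alg : ∀ u t → 1ℤ * 1ℤ * 1ℤ + 0ℤ - u * (t * 0ℤ) ≡ 1ℤ
    alg = solve-∀
  cassini (suc n) = begin
    Ψ[ suc n ] * Ψ[ suc n ] - u * (Θ[ suc (suc n) ] * T)
      ≡⟨ cong (λ x → Ψ[ suc n ] * Ψ[ suc n ] - u * (x * T)) (Θ-suc (suc n)) ⟩
    Ψ[ suc n ] * Ψ[ suc n ] - u * ((Ψ[ suc n ] - v * T) * T)
      ≡⟨ cong (λ x → x * x - u * ((x - v * T) * T)) (Ψ-suc n) ⟩
    (u * T - v * P) * (u * T - v * P) - u * (((u * T - v * P) - v * T) * T)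
      ≡⟨ expand u v T P ⟩
    v * v * (P * P) - u * v * (T * (P - T))
      ≡⟨ cong (λ x → v * v * (P * P) - u * v * (T * (P - x))) (Θ-suc n) ⟩
    v * v * (P * P) - u * v * (T * (P - (P - v * Θ[ n ])))
      ≡⟨ collect u v T P Θ[ n ] ⟩
    v * v * (P * P - u * (T * Θ[ n ]))
      ≡⟨ cong (v * v *_) (cassini n) ⟩
    v * v * (v * v) ^ n ∎
    where
    T = Θ[ suc n ]
    P = Ψ[ n ]
    expand : ∀ u v T P → (u * T - v * P) * (u * T - v * P) - u * (((u * T - v * P) - v * T) * T)
                         ≡ v * v * (P * P) - u * v * (T * (P - T))
    expand = solve-∀
    collect : ∀ u v T P R → v * v * (P * P) - u * v * (T * (P - (P - v * R)))
                            ≡ v * v * (P * P - u * (T * R))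
    collect = solve-∀

  Ψ≡u^n+v*r : ∀ n → ∃[ r ] Ψ[ n ] ≡ u ^ n + v * r
  Ψ≡u^n+v*r zero    = 0ℤ , alg v
    where
    alg : ∀ v → 1ℤ * 1ℤ * 1ℤ + 0ℤ ≡ 1ℤ + v * 0ℤ
    alg = solve-∀
  Ψ≡u^n+v*r (suc n) = ⟦ form n (divY ψ) ⟧ ,
    trans (eval-form-suc n ψ) (cong (_+ v * ⟦ form n (divY ψ) ⟧) (ℤₚ.*-identityˡ (u ^ suc n)))

  nΨ≡[u-4v]∂XΨ+[2n+1]vΘ : ∀ n → + n * Ψ[ n ] ≡ (u - + 4 * v) * ⟦ ∂X (form n ψ) ⟧ + + suc (2 ℕ.* n) * (v * Θ[ n ])
  nΨ≡[u-4v]∂XΨ+[2n+1]vΘ zero    = alg u v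
    where
    alg : ∀ u v → 0ℤ * (1ℤ * 1ℤ * 1ℤ + 0ℤ) ≡ (u - + 4 * v) * 0ℤ + 1ℤ * (v * 0ℤ)
    alg = solve-∀
  nΨ≡[u-4v]∂XΨ+[2n+1]vΘ (suc k) = begin
    + suc k * Ψ[ suc k ]
      ≡⟨ eval-form-* (suc k) (+ suc k) ψ ⟨
    ⟦ form (suc k) (λ a b → + suc k * ψ a b) ⟧
      ≡⟨ cong ⟦_⟧ (form-cong (suc k) λ {a} {b} → pointwise {a} {b}) ⟩
    ⟦ form (suc k) (λ a b → E a b + q * mulY θ a b) ⟧
      ≡⟨ eval-form-+ (suc k) E (λ a b → q * mulY θ a b) ⟩
    ⟦ form (suc k) E ⟧ + ⟦ form (suc k) (λ a b → q * mulY θ a b) ⟧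
      ≡⟨ cong₂ _+_ (sym (eval-[X-4Y]∂X-form k ψ)) (eval-form-* (suc k) q (mulY θ)) ⟩
    (u - + 4 * v) * ⟦ ∂X (form (suc k) ψ) ⟧ + q * ⟦ form (suc k) (mulY θ) ⟧
      ≡⟨ cong (λ x → (u - + 4 * v) * ⟦ ∂X (form (suc k) ψ) ⟧ + q * x) (eval-form-mulY k θ) ⟩
    (u - + 4 * v) * ⟦ ∂X (form (suc k) ψ) ⟧ + q * (v * Θ[ suc k ]) ∎
    where
    q = + suc (2 ℕ.* suc k)
    E : ℕ → ℕ → ℤ
    E a b = + a * ψ a b - + 4 * mulY (∂X-coeff ψ) a b
    pointwise : ∀ {a b} → a ℕ.+ b ≡ suc k → + suc k * ψ a b ≡ E a b + q * mulY θ a b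
    pointwise {a} {b} a+b≡1+k =
      subst (λ d → + d * ψ a b ≡ E a b + + suc (2 ℕ.* d) * mulY θ a b) a+b≡1+k ([a+b]ψ≡[X-4Y]∂Xψ+[2a+2b+1]Yθ a b)

  module _ {ℓ} (ℓ-prime : Prime ℓ) (m : ℕ) (ℓ∤2m+1 : ¬ ℓ ∣ℕ suc (2 ℕ.* m))
           (ℓ∣Ψ : + ℓ ∣ₛ Ψ[ m ]) (ℓ∤u∧v : ¬ (+ ℓ ∣ₛ u × + ℓ ∣ₛ v)) where

    ∣uΘΘ⇒∣v : + ℓ ∣ₛ u * (Θ[ suc m ] * Θ[ m ]) → + ℓ ∣ₛ v
    ∣uΘΘ⇒∣v ℓ∣uΘΘ = reduce (∣m*n⇒∣m⊎∣n ℓ-prime v v (∣m^n⇒∣m ℓ-prime (v * v) m ℓ∣[v*v]^m))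
      where
      ℓ∣[v*v]^m : + ℓ ∣ₛ (v * v) ^ m
      ℓ∣[v*v]^m = subst (+ ℓ ∣ₛ_) (cassini m) (∣m∣n⇒∣m-n (∣m⇒∣m*n Ψ[ m ] ℓ∣Ψ) ℓ∣uΘΘ)

    ℓ∤u : ¬ + ℓ ∣ₛ u
    ℓ∤u ℓ∣u = ℓ∤u∧v (ℓ∣u , ∣uΘΘ⇒∣v (∣m⇒∣m*n (Θ[ suc m ] * Θ[ m ]) ℓ∣u))

    ℓ∤v : ¬ + ℓ ∣ₛ v
    ℓ∤v ℓ∣v = ℓ∤u∧v (∣m^n⇒∣m ℓ-prime u m ℓ∣uᵐ , ℓ∣v)
      where
      ℓ∣uᵐ : + ℓ ∣ₛ u ^ m
      ℓ∣uᵐ with r , Ψ≡uᵐ+vr ← Ψ≡u^n+v*r m =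
        ∣m+n∣n⇒∣m (subst (+ ℓ ∣ₛ_) Ψ≡uᵐ+vr ℓ∣Ψ) (∣m⇒∣m*n r ℓ∣v)

    ∂XΨ ∂YΨ : ℤ
    ∂XΨ = ⟦ ∂X (form m ψ) ⟧
    ∂YΨ = ⟦ ∂Y (form m ψ) ⟧

    ∣∂XΨ*∂YΨ⇒∣∂XΨ : + ℓ ∣ₛ ∂XΨ * ∂YΨ → + ℓ ∣ₛ ∂XΨ
    ∣∂XΨ*∂YΨ⇒∣∂XΨ ℓ∣∂XΨ*∂YΨ = [ id , ∣∂YΨ⇒∣∂XΨ ] (∣m*n⇒∣m⊎∣n ℓ-prime ∂XΨ ∂YΨ ℓ∣∂XΨ*∂YΨ)
      where
      ∣∂YΨ⇒∣∂XΨ : + ℓ ∣ₛ ∂YΨ → + ℓ ∣ₛ ∂XΨ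
      ∣∂YΨ⇒∣∂XΨ ℓ∣∂YΨ = ∣m*n∧∤m⇒∣n ℓ-prime u ∂XΨ (∣m+n∣n⇒∣m ℓ∣u∂X+v∂Y (∣n⇒∣m*n v ℓ∣∂YΨ)) ℓ∤u
        where
        ℓ∣u∂X+v∂Y : + ℓ ∣ₛ u * ∂XΨ + v * ∂YΨ
        ℓ∣u∂X+v∂Y = subst (+ ℓ ∣ₛ_) (sym (euler (form m ψ) (form-homogeneous m ψ))) (∣n⇒∣m*n (+ m) ℓ∣Ψ)

    ∣∂XΨ⇒∣Θ : + ℓ ∣ₛ ∂XΨ → + ℓ ∣ₛ Θ[ m ]
    ∣∂XΨ⇒∣Θ ℓ∣∂XΨ = ∣m*n∧∤m⇒∣n ℓ-prime v Θ[ m ] (∣m*n∧∤m⇒∣n ℓ-prime q (v * Θ[ m ]) ℓ∣q*vΘ ℓ∤q) ℓ∤v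
      where
      q = + suc (2 ℕ.* m)
      ℓ∤q : ¬ + ℓ ∣ₛ q
      ℓ∤q ℓ∣q = ℓ∤2m+1 (∣⇒∣ᵤ ℓ∣q)
      ℓ∣q*vΘ : + ℓ ∣ₛ q * (v * Θ[ m ])
      ℓ∣q*vΘ = ∣m+n∣m⇒∣n (subst (+ ℓ ∣ₛ_) (nΨ≡[u-4v]∂XΨ+[2n+1]vΘ m) (∣n⇒∣m*n (+ m) ℓ∣Ψ)) (∣n⇒∣m*n (u - + 4 * v) ℓ∣∂XΨ)

    ℓ∤∂XΨ*∂YΨ : ¬ + ℓ ∣ₛ ∂XΨ * ∂YΨ
    ℓ∤∂XΨ*∂YΨ = ℓ∤v ∘ ∣uΘΘ⇒∣v ∘ ∣n⇒∣m*n u ∘ ∣n⇒∣m*n Θ[ suc m ] ∘ ∣∂XΨ⇒∣Θ ∘ ∣∂XΨ*∂YΨ⇒∣∂XΨ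

lemma20 : (q ℓ : ℕ) → Prime q → Prime ℓ → q ≢ ℓ → ¬ (2 ∣ℕ q) →
    (u v : ℤ) → (+ ℓ) ∣ eval (Ψ q) u v → ¬ ((+ ℓ) ∣ u × (+ ℓ) ∣ v) →
    ¬ ((+ ℓ) ∣ (eval (∂X (Ψ q)) u v * eval (∂Y (Ψ q)) u v))
lemma20 q ℓ q-prime ℓ-prime q≢ℓ 2∤q u v ℓ∣Ψq ℓ∤u∧v ℓ∣∂XΨq*∂YΨq =
  ℓ∤∂XΨ*∂YΨ u v ℓ-prime (q / 2) ℓ∤2m+1
    (∣ᵤ⇒∣ (subst (λ p → + ℓ ∣ eval p u v) (Ψ≡form q) ℓ∣Ψq))
    (λ (ℓ∣u , ℓ∣v) → ℓ∤u∧v (∣⇒∣ᵤ ℓ∣u , ∣⇒∣ᵤ ℓ∣v))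
    (∣ᵤ⇒∣ (subst (λ p → + ℓ ∣ eval (∂X p) u v * eval (∂Y p) u v) (Ψ≡form q) ℓ∣∂XΨq*∂YΨq))
  where
  ℓ∤q : ¬ ℓ ∣ℕ q
  ℓ∤q ℓ∣q = [ ℕ.nonTrivial⇒≢1 {{prime⇒nonTrivial ℓ-prime}} , q≢ℓ ∘ sym ] (prime⇒irreducible q-prime ℓ∣q)
  ℓ∤2m+1 : ¬ ℓ ∣ℕ suc (2 ℕ.* (q / 2))
  ℓ∤2m+1 = ℓ∤q ∘ subst (ℓ ∣ℕ_) (sym (¬2∣n⇒n≡1+2*[n/2] q 2∤q))
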